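{- Let $R,c$ be integers and let $A,B$ be coprime squarefree positive integers. Then \[\Delta_{R,c}(AB)=\Delta_{RA,\Delta_{R,c}(A)}(B)\quad\text{and}\quad \Delta_{R,c}(AB)=\Delta_{RB,\Delta_{R,c}(B)}(A).\]
   Context: $\partial$ denotes the arithmetic derivative: $\partial(p)=1$ for primes $p$, $\partial(ab)=a\partial(b)+b\partial(a)$ (so $\partial(1)=0$ and $\partial(n)=\sum_{p\mid n}n/p$ for squarefree $n$). For integers $R,c$ and a squarefree positive integer $B$, define $\Delta_{R,c}(B)=cB-R\,\partial(B)$. -}

module Defs where

open import Data.Nat as ℕ using (ℕ; zero; suc; NonZero)
open import Data.Nat.Divisibility using (_∣_; _∣?_)
open import Data.Nat.Primality using (Prime; prime?)
open import Data.Nat.DivMod using (_/_)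
open import Data.List using (List; map; upTo)
open import Data.Nat.ListAction using (sum)
open import Data.Integer as ℤ using (ℤ; +_)
open import Relation.Nullary using (¬_; yes; no)
open import Relation.Nullary.Decidable using (⌊_⌋)
open import Data.Bool using (if_then_else_)

SquareFree : ℕ → Set
SquareFree n = ∀ p → Prime p → ¬ (p ℕ.* p ∣ n)

-- p-adic valuation of n (meaningful for n > 0, p ≥ 2), computed with fuel n.
valuation : ℕ → ℕ → ℕ
valuation p n = go n n
  where
  go : ℕ → ℕ → ℕ
  go zero m = 0
  go (suc fuel) m with p ∣? m
  ... | no _  = 0
  ... | yes _ = suc (go fuel (m / suc (ℕ.pred p)))

-- Arithmetic derivative on positive integers:
--   ∂(n) = Σ_{p prime, p ≤ n} v_p(n) · (n / p)
-- (with ∂(0) = 0 by this formula).  This satisfies ∂(p) = 1 for primes,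
-- the Leibniz rule, and ∂(n) = Σ_{p ∣ n} n/p for squarefree n.
term : ℕ → ℕ → ℕ
term n zero    = 0
term n (suc q) = if ⌊ prime? (suc q) ⌋ then valuation (suc q) n ℕ.* (n / suc q) else 0

∂ : ℕ → ℕ
∂ n = sum (map (term n) (upTo (suc n)))

Δ : ℤ → ℤ → ℕ → ℤ
Δ R c B = c ℤ.* + B ℤ.- R ℤ.* + ∂ B

{-# OPTIONS --safe #-}
-- For squarefree n the p-th summand of ∂ n is n / p if p is a prime divisor of n and 0 otherwise.
-- If m and n are coprime and squarefree, a prime divides at most one of them and m n is again
-- squarefree, so the summands obey the Leibniz rule ∂(m n) = n ∂m + m ∂n one prime at a time.
-- Given this rule, Δ R c (m n) = Δ (R m) (Δ R c m) n is an identity of commutative rings, and the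
-- second identity is the first one with m and n exchanged.

module Submission where

open import Defs
open import Data.Nat as ℕ using (ℕ; NonZero)
open import Data.Nat.Coprimality using (Coprime)
open import Data.Integer as ℤ using (ℤ; +_)
open import Data.Product using (_×_)
open import Relation.Binary.PropositionalEquality using (_≡_)

open import Data.Nat using (zero; suc; _+_; _*_; _≤_; _<_; _≤′_; ≤′-refl; ≤′-step; s≤s)
open import Data.Nat.Properties
  using (*-comm; *-assoc; +-comm; *-zeroʳ; +-identityʳ; <⇒≱; ≤⇒≤′; ≤′⇒≤; m≤m*n; m≤n*m; m*n≢0)
open import Data.Nat.Divisibility
  using (_∣_; _∤_; _∣?_; divides-refl; ∣-trans; m∣m*n; ∣⇒≤; *-cancelˡ-∣; *-monoˡ-∣; m∣n/o⇒o*m∣n)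
open import Data.Nat.DivMod using (_/_; *-/-assoc)
open import Data.Nat.Primality using (Prime; prime?; ¬prime[1]; prime⇒nonZero; euclidsLemma)
import Data.Nat.Coprimality as Coprime
open import Data.Nat.ListAction using (sum)
open import Data.Nat.ListAction.Properties using (sum-++)
open import Data.Nat.Tactic.RingSolver using (solve-∀)
open import Data.Integer.Properties using (pos-+; pos-*)
import Data.Integer.Tactic.RingSolver as ℤ-Solver
open import Data.List using ([]; _∷_; _++_; map; upTo)
open import Data.List.Properties using (map-++; upTo-∷ʳ)
open import Data.Sum using (inj₁; inj₂; [_,_])
open import Function using (_∘_)
open import Data.Product using (_,_)
open import Relation.Nullary using (¬_; yes; no; contradiction)
open import Relation.Binary.PropositionalEquality using (refl; sym; trans; cong; cong₂; subst; module ≡-Reasoning)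

private
  variable
    m n p : ℕ

sum-map-linear : ∀ {ℓ} {A : Set ℓ} (f g h : A → ℕ) (k l : ℕ) → (∀ x → f x ≡ k * g x + l * h x) →
                 ∀ xs → sum (map f xs) ≡ k * sum (map g xs) + l * sum (map h xs)
sum-map-linear f g h k l f≡ []       = sym (cong₂ _+_ (*-zeroʳ k) (*-zeroʳ l))
sum-map-linear f g h k l f≡ (x ∷ xs) = begin
  f x + sum (map f xs)
    ≡⟨ cong₂ _+_ (f≡ x) (sum-map-linear f g h k l f≡ xs) ⟩
  (k * g x + l * h x) + (k * sum (map g xs) + l * sum (map h xs))
    ≡⟨ regroup k l (g x) (h x) (sum (map g xs)) (sum (map h xs)) ⟩
  k * (g x + sum (map g xs)) + l * (h x + sum (map h xs)) ∎
  where
  open ≡-Reasoning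
  regroup : ∀ k l a b c d → (k * a + l * b) + (k * c + l * d) ≡ k * (a + c) + l * (b + d)
  regroup = solve-∀

sum-map-upTo-extend : ∀ (f : ℕ → ℕ) → (∀ i → m ≤ i → f i ≡ 0) → m ≤ n →
                      sum (map f (upTo n)) ≡ sum (map f (upTo m))
sum-map-upTo-extend {m} f vanishes m≤n = extend (≤⇒≤′ m≤n)
  where
  open ≡-Reasoning
  extend : m ≤′ n → sum (map f (upTo n)) ≡ sum (map f (upTo m))
  extend ≤′-refl = refl
  extend (≤′-step {n} m≤′n) = begin
    sum (map f (upTo (suc n)))          ≡⟨ cong (sum ∘ map f) (upTo-∷ʳ n) ⟨
    sum (map f (upTo n ++ n ∷ []))      ≡⟨ cong sum (map-++ f (upTo n) (n ∷ [])) ⟩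
    sum (map f (upTo n) ++ f n ∷ [])    ≡⟨ sum-++ (map f (upTo n)) (f n ∷ []) ⟩
    sum (map f (upTo n)) + (f n + 0)    ≡⟨ cong (λ t → sum (map f (upTo n)) + (t + 0)) (vanishes n (≤′⇒≤ m≤′n)) ⟩
    sum (map f (upTo n)) + 0            ≡⟨ +-identityʳ _ ⟩
    sum (map f (upTo n))                ≡⟨ extend m≤′n ⟩
    sum (map f (upTo m))                ∎

valuation-∤ : p ∤ n → valuation p n ≡ 0
valuation-∤ {n = zero}  _   = refl
valuation-∤ {p} {suc n} p∤n with p ∣? suc n
... | yes p∣n = contradiction p∣n p∤n
... | no  _   = refl

valuation-∣∧²∤ : .{{_ : NonZero p}} .{{_ : NonZero n}} → p ∣ n → ¬ p * p ∣ n →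
                 valuation p n ≡ 1
-- `valuation` runs on fuel n, so for n = 1 it stops after the first division.
valuation-∣∧²∤ {suc q} {suc n} p∣n p²∤n with suc q ∣? suc n
... | no p∤n = contradiction p∣n p∤n
valuation-∣∧²∤ {suc q} {suc zero}    p∣n p²∤n | yes _ = refl
valuation-∣∧²∤ {suc q} {suc (suc n)} p∣n p²∤n | yes _ with suc q ∣? suc (suc n) / suc q
... | yes p∣n/p = contradiction (m∣n/o⇒o*m∣n p∣n p∣n/p) p²∤n
... | no  _     = refl

term-∤ : p ∤ n → term n p ≡ 0
term-∤ {zero}  _   = refl
term-∤ {suc q} p∤n with prime? (suc q)
... | yes _ rewrite valuation-∤ p∤n = refl
... | no  _ = refl

term-¬prime : ¬ Prime p → term n p ≡ 0
term-¬prime {zero}  _     = refl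
term-¬prime {suc q} ¬p-prime with prime? (suc q)
... | yes p-prime = contradiction p-prime ¬p-prime
... | no  _       = refl

term-squareFree : .{{_ : NonZero p}} .{{_ : NonZero n}} → SquareFree n → Prime p → p ∣ n →
                  term n p ≡ n / p
term-squareFree {suc q} {n} sf p-prime p∣n with prime? (suc q)
... | no ¬p-prime = contradiction p-prime ¬p-prime
... | yes _ rewrite valuation-∣∧²∤ p∣n (sf (suc q) p-prime) = +-identityʳ (n / suc q)

term-> : .{{_ : NonZero n}} → n < p → term n p ≡ 0
term-> n<p = term-∤ (λ p∣n → <⇒≱ n<p (∣⇒≤ p∣n))

coprime-prime∤ʳ : Coprime m n → Prime p → p ∣ m → p ∤ n
coprime-prime∤ʳ coprime p-prime p∣m p∣n = ¬prime[1] (subst Prime (coprime (p∣m , p∣n)) p-prime)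

prime²∤-* : Coprime m n → SquareFree m → Prime p → p ∣ m → ¬ p * p ∣ m * n
prime²∤-* {n = n} {p} coprime sfm p-prime p∣m@(divides-refl q) p²∣qpn
  with euclidsLemma q n p-prime (*-cancelˡ-∣ p (subst (p * p ∣_) qpn≡pqn p²∣qpn))
  where
  instance _ = prime⇒nonZero p-prime
  qpn≡pqn : q * p * n ≡ p * (q * n)
  qpn≡pqn = trans (cong (_* n) (*-comm q p)) (*-assoc p q n)
... | inj₁ p∣q = sfm p p-prime (*-monoˡ-∣ p p∣q)
... | inj₂ p∣n = coprime-prime∤ʳ coprime p-prime p∣m p∣n

squareFree-* : Coprime m n → SquareFree m → SquareFree n → SquareFree (m * n)
squareFree-* {m} {n} coprime sfm sfn p p-prime p²∣mn
  with euclidsLemma m n p-prime (∣-trans (m∣m*n p) p²∣mn)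
... | inj₁ p∣m = prime²∤-* coprime sfm p-prime p∣m p²∣mn
... | inj₂ p∣n =
  prime²∤-* (Coprime.sym coprime) sfn p-prime p∣n (subst (p * p ∣_) (*-comm m n) p²∣mn)

term-*-∣ˡ : .{{_ : NonZero m}} .{{_ : NonZero n}} → Coprime m n → SquareFree m → SquareFree n →
            Prime p → p ∣ m → term (m * n) p ≡ n * term m p + m * term n p
term-*-∣ˡ {m} {n} {p} coprime sfm sfn p-prime p∣m = begin
  term (m * n) p              ≡⟨ term-squareFree (squareFree-* coprime sfm sfn) p-prime (∣-trans p∣m (m∣m*n n)) ⟩
  m * n / p                   ≡⟨ cong (_/ p) (*-comm m n) ⟩
  n * m / p                   ≡⟨ *-/-assoc n p∣m ⟩
  n * (m / p)                 ≡⟨ cong (n *_) (term-squareFree sfm p-prime p∣m) ⟨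
  n * term m p                ≡⟨ +-identityʳ (n * term m p) ⟨
  n * term m p + 0            ≡⟨ cong (λ t → n * term m p + t) (*-zeroʳ m) ⟨
  n * term m p + m * 0        ≡⟨ cong (λ t → n * term m p + m * t) (term-∤ (coprime-prime∤ʳ coprime p-prime p∣m)) ⟨
  n * term m p + m * term n p ∎
  where
  open ≡-Reasoning
  instance _ = prime⇒nonZero p-prime
  instance _ = m*n≢0 m n

term-* : .{{_ : NonZero m}} .{{_ : NonZero n}} → Coprime m n → SquareFree m → SquareFree n →
         ∀ p → term (m * n) p ≡ n * term m p + m * term n p
term-* {m} {n} coprime sfm sfn p with prime? p
... | no ¬p-prime
  rewrite term-¬prime {n = m * n} ¬p-prime | term-¬prime {n = m} ¬p-prime | term-¬prime {n = n} ¬p-prime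
  = sym (cong₂ _+_ (*-zeroʳ n) (*-zeroʳ m))
... | yes p-prime with p ∣? m | p ∣? n
... | yes p∣m | _ = term-*-∣ˡ coprime sfm sfn p-prime p∣m
... | no _ | yes p∣n = begin
  term (m * n) p              ≡⟨ cong (λ k → term k p) (*-comm m n) ⟩
  term (n * m) p              ≡⟨ term-*-∣ˡ (Coprime.sym coprime) sfn sfm p-prime p∣n ⟩
  m * term n p + n * term m p ≡⟨ +-comm (m * term n p) (n * term m p) ⟩
  n * term m p + m * term n p ∎
  where open ≡-Reasoning
... | no p∤m | no p∤n
  rewrite term-∤ {n = m * n} ([ p∤m , p∤n ] ∘ euclidsLemma m n p-prime) | term-∤ p∤m | term-∤ p∤n
  = sym (cong₂ _+_ (*-zeroʳ n) (*-zeroʳ m))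

∂-upTo : ∀ {N} .{{_ : NonZero n}} → n ≤ N → ∂ n ≡ sum (map (term n) (upTo (suc N)))
∂-upTo {n} n≤N = sym (sum-map-upTo-extend (term n) (λ _ n<i → term-> n<i) (s≤s n≤N))

∂-* : .{{_ : NonZero m}} .{{_ : NonZero n}} → Coprime m n → SquareFree m → SquareFree n →
      ∂ (m * n) ≡ n * ∂ m + m * ∂ n
∂-* {m} {n} coprime sfm sfn = begin
  ∂ (m * n)
    ≡⟨ sum-map-linear (term (m * n)) (term m) (term n) n m (term-* coprime sfm sfn) (upTo (suc (m * n))) ⟩
  n * sum (map (term m) (upTo (suc (m * n)))) + m * sum (map (term n) (upTo (suc (m * n))))
    ≡⟨ cong₂ (λ s t → n * s + m * t) (∂-upTo (m≤m*n m n)) (∂-upTo (m≤n*m n m)) ⟨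
  n * ∂ m + m * ∂ n ∎
  where open ≡-Reasoning

Δ-* : ∀ R c m n → ∂ (m * n) ≡ n * ∂ m + m * ∂ n → Δ R c (m * n) ≡ Δ (R ℤ.* + m) (Δ R c m) n
Δ-* R c m n leibniz = begin
  c ℤ.* + (m * n) ℤ.- R ℤ.* + ∂ (m * n)
    ≡⟨ cong₂ (λ s t → c ℤ.* s ℤ.- R ℤ.* t) (pos-* m n) leibnizℤ ⟩
  c ℤ.* (+ m ℤ.* + n) ℤ.- R ℤ.* (+ n ℤ.* + ∂ m ℤ.+ + m ℤ.* + ∂ n)
    ≡⟨ regroup R c (+ m) (+ n) (+ ∂ m) (+ ∂ n) ⟩
  (c ℤ.* + m ℤ.- R ℤ.* + ∂ m) ℤ.* + n ℤ.- (R ℤ.* + m) ℤ.* + ∂ n ∎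
  where
  open ≡-Reasoning
  leibnizℤ : + ∂ (m * n) ≡ + n ℤ.* + ∂ m ℤ.+ + m ℤ.* + ∂ n
  leibnizℤ = trans (cong +_ leibniz)
               (trans (pos-+ (n * ∂ m) (m * ∂ n)) (cong₂ ℤ._+_ (pos-* n (∂ m)) (pos-* m (∂ n))))
  regroup : ∀ R c m n dm dn → c ℤ.* (m ℤ.* n) ℤ.- R ℤ.* (n ℤ.* dm ℤ.+ m ℤ.* dn)
                             ≡ (c ℤ.* m ℤ.- R ℤ.* dm) ℤ.* n ℤ.- (R ℤ.* m) ℤ.* dn
  regroup = ℤ-Solver.solve-∀

mainTheorem5 : (R c : ℤ) (A B : ℕ) → NonZero A → NonZero B → SquareFree A → SquareFree B → Coprime A B →
    (Δ R c (A ℕ.* B) ≡ Δ (R ℤ.* + A) (Δ R c A) B) × (Δ R c (A ℕ.* B) ≡ Δ (R ℤ.* + B) (Δ R c B) A)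
mainTheorem5 R c A B nzA nzB sfA sfB coprime =
    Δ-* R c A B (∂-* {{nzA}} {{nzB}} coprime sfA sfB)
  , trans (cong (Δ R c) (*-comm A B)) (Δ-* R c B A (∂-* {{nzB}} {{nzA}} (Coprime.sym coprime) sfB sfA))
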